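{- Let $k$ be an algebraic number field and let $C$ be a cubic form over $k$ in $n$ variables with $h = h_k(C)$ satisfying $11 \leq h = n-4$. Write, in $k$-rational coordinates $(\mathbf{x},\mathbf{y}) = (x_1,\dots,x_4,y_1,\dots,y_h)$, $C(\mathbf{x},\mathbf{y}) = \sum_{i=1}^h y_i Q_i(\mathbf{x}) + 2\sum_{j=1}^4 x_j q_j(\mathbf{y}) + c(\mathbf{y})$ with $Q_i,q_j$ quadratic forms and $c$ a cubic form over $k$, and let $M_i$ be the symmetric $4\times 4$ matrix with $Q_i(\mathbf{x}) = \mathbf{x}^T M_i \mathbf{x}$. Then $C$ is strongly equivalent to a cubic form $C'(\mathbf{x},\mathbf{y}') = \sum_{i=1}^h y'_i Q'_i(\mathbf{x}) + 2\sum_{j=1}^4 x_j q'_j(\mathbf{y}') + c'(\mathbf{y}')$ whose corresponding matrices $M'_i$ (with $Q'_i(\mathbf{x}) = \mathbf{x}^T M'_i\mathbf{x}$) satisfy $M'_i = 0$ for at least $h-10$ indices $i$.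
   Context: The $h$-invariant $h_k(C)$ is the smallest positive integer $h$ such that $C$ can be written identically as $\sum_{i=1}^h L_i Q_i$ with $L_i$ linear and $Q_i$ quadratic forms with coefficients in $k$. $C$ is strongly equivalent to $C'$ if there is a non-singular $k$-rational linear change of the $\mathbf{y}$-variables only, $y'_j = L'_j(\mathbf{y})$ ($j=1,\dots,h$), such that $C(\mathbf{x},\mathbf{y}) = C'(\mathbf{x},\mathbf{y}')$. -}

module Defs where

open import Level using (Level; _⊔_) renaming (suc to lsuc)
open import Algebra.Bundles using (CommutativeRing)
open import Data.Nat using (ℕ; _≤_; _∸_)
open import Data.Fin using (Fin)
open import Data.Fin.Subset using (Subset; _∈_; ∣_∣)
open import Data.Vec.Functional using (Vector; _++_)
open import Data.Product using (Σ; ∃; _×_; _,_)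
open import Data.Rational as ℚ using (ℚ)
open import Relation.Nullary using (¬_)
open import Relation.Binary.PropositionalEquality using (_≡_)
import Algebra.Definitions.RawMonoid as RM

record Field (c ℓ : Level) : Set (lsuc (c ⊔ ℓ)) where
  field
    commutativeRing : CommutativeRing c ℓ
  open CommutativeRing commutativeRing public
  field
    0≉1     : ¬ (0# ≈ 1#)
    inverse : ∀ x → ¬ (x ≈ 0#) → Σ Carrier λ y → x * y ≈ 1#

record IsNumberField {c ℓ : Level} (F : Field c ℓ) : Set (c ⊔ ℓ) where
  open Field F
  field
    ι       : ℚ → Carrier
    ι-1     : ι ℚ.1ℚ ≈ 1#
    ι-+     : ∀ p q → ι (p ℚ.+ q) ≈ ι p + ι q
    ι-*     : ∀ p q → ι (p ℚ.* q) ≈ ι p * ι q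
    degree  : ℕ
    basis   : Fin degree → Carrier
    spans   : ∀ x → Σ (Fin degree → ℚ) λ a →
                x ≈ RM.sum +-rawMonoid (λ i → ι (a i) * basis i)
    indep   : ∀ (a : Fin degree → ℚ) →
                RM.sum +-rawMonoid (λ i → ι (a i) * basis i) ≈ 0# →
                ∀ i → a i ≡ ℚ.0ℚ

module Forms {c ℓ : Level} (F : Field c ℓ) where
  open Field F

  Σ[_] : ∀ {n} → Vector Carrier n → Carrier
  Σ[ v ] = RM.sum +-rawMonoid v

  LinearForm : ℕ → Set c
  LinearForm n = Fin n → Carrier

  QuadForm : ℕ → Set c
  QuadForm n = Fin n → Fin n → Carrier

  CubicForm : ℕ → Set c
  CubicForm n = Fin n → Fin n → Fin n → Carrier

  evalL : ∀ {n} → LinearForm n → Vector Carrier n → Carrier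
  evalL L x = Σ[ (λ a → L a * x a) ]

  evalQ : ∀ {n} → QuadForm n → Vector Carrier n → Carrier
  evalQ M x = Σ[ (λ a → Σ[ (λ b → M a b * x a * x b) ]) ]

  evalC : ∀ {n} → CubicForm n → Vector Carrier n → Carrier
  evalC T x = Σ[ (λ a → Σ[ (λ b → Σ[ (λ d → T a b d * x a * x b * x d) ]) ]) ]

  Symmetric : ∀ {n} → QuadForm n → Set ℓ
  Symmetric M = ∀ a b → M a b ≈ M b a

  HasDecomp : ∀ {n} → CubicForm n → ℕ → Set (c ⊔ ℓ)
  HasDecomp {n} C h = Σ (Fin h → LinearForm n) λ L → Σ (Fin h → QuadForm n) λ Q →
    ∀ x → evalC C x ≈ Σ[ (λ i → evalL (L i) x * evalQ (Q i) x) ]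

  HInvariant : ∀ {n} → CubicForm n → ℕ → Set (c ⊔ ℓ)
  HInvariant C h = (1 ≤ h) × HasDecomp C h ×
    (∀ h′ → 1 ≤ h′ → HasDecomp C h′ → h ≤ h′)

  _·_ : ∀ {m n} → (Fin m → Fin n → Carrier) → Vector Carrier n → Vector Carrier m
  (A · y) i = Σ[ (λ j → A i j * y j) ]

  Invertible : ∀ {h} → (Fin h → Fin h → Carrier) → Set (c ⊔ ℓ)
  Invertible {h} A = Σ (Fin h → Fin h → Carrier) λ B →
    (∀ i j → Σ[ (λ k → A i k * B k j) ] ≈ δ i j) ×
    (∀ i j → Σ[ (λ k → B i k * A k j) ] ≈ δ i j)
    where
    open import Data.Fin using (_≟_)
    open import Relation.Nullary using (yes; no)
    δ : Fin h → Fin h → Carrier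
    δ i j with i ≟ j
    ... | yes _ = 1#
    ... | no  _ = 0#

  shape : ∀ {h} → (Fin h → QuadForm 4) → (Fin 4 → QuadForm h) → CubicForm h →
          Vector Carrier 4 → Vector Carrier h → Carrier
  shape M q cc x y =
    Σ[ (λ i → y i * evalQ (M i) x) ]
    + (1# + 1#) * Σ[ (λ j → x j * evalQ (q j) y) ]
    + evalC cc y

{-# OPTIONS --safe #-}
module Submission where

-- The matrices M_i lie in the 10-dimensional space of symmetric 4 × 4 matrices.
-- Gaussian elimination on the h × 10 matrix of their upper-triangular entries
-- yields an invertible P and matrices M′_k, at least h − 10 of them zero, with
-- M_i = Σ_k P_ik M′_k.  The substitution y′ = Pᵀ y turns Σ_i y_i M_i into
-- Σ_k y′_k M′_k, and q_j and c are rewritten in y′ by pulling them back along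
-- (Pᵀ)⁻¹.  The pivot search needs x ≈ 0 to be decidable; over a number field
-- it is, because x is zero exactly when its rational coordinates in a ℚ-basis are.

open import Level using (_⊔_)
open import Algebra.Bundles using (CommutativeRing)
open import Data.Bool using (false)
open import Data.Empty using (⊥-elim)
open import Data.Nat using (ℕ; zero; suc; _≤_; _∸_)
open import Data.Nat.Properties using (≤-trans; ≤-reflexive; ∸-monoʳ-≤; n≤1+n)
open import Data.Fin using (Fin; zero; suc; _≟_)
open import Data.Fin.Patterns using (0F; 1F; 2F; 3F; 4F; 5F; 6F; 7F; 8F; 9F)
open import Data.Fin.Properties using (all?; ¬∀⟶∃¬)
open import Data.Fin.Permutation as Perm using (Permutation; _⟨$⟩ʳ_)
open import Data.Fin.Subset using (Subset; _∈_; ∣_∣; ⊤)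
open import Data.Fin.Subset.Properties using (∣⊤∣≡n)
open import Data.Product using (Σ; _×_; _,_; proj₁; proj₂)
open import Data.Rational as ℚ using ()
open import Data.Rational.Properties as ℚ using ()
open import Data.Vec.Base using (_∷_; there)
open import Data.Vec.Functional as Vector using (_++_)
open import Relation.Nullary using (¬_; Dec; yes; no)
open import Relation.Binary.PropositionalEquality as ≡ using (_≡_; _≢_)

open import Defs

module MatrixAlgebra {c ℓ} (R : CommutativeRing c ℓ) where
  open CommutativeRing R hiding (zero)
  open import Algebra.Properties.Semiring.Sum semiring
    using (sum; sum-cong-≋; sum-replicate-zero; ∑-comm; *-distribˡ-sum; *-distribʳ-sum)
  open import Relation.Binary.Reasoning.Setoid setoid

  private
    variable
      m n p q : ℕ

  sum-≈0 : (f : Fin n → Carrier) → (∀ i → f i ≈ 0#) → sum f ≈ 0#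
  sum-≈0 {n} f f≈0 = trans (sum-cong-≋ f≈0) (sum-replicate-zero n)

  Matrix : ℕ → ℕ → Set c
  Matrix m n = Fin m → Fin n → Carrier

  infix 4 _≋_
  _≋_ : Matrix m n → Matrix m n → Set ℓ
  X ≋ Y = ∀ i j → X i j ≈ Y i j

  ≋-trans : {X Y Z : Matrix m n} → X ≋ Y → Y ≋ Z → X ≋ Z
  ≋-trans X≋Y Y≋Z i j = trans (X≋Y i j) (Y≋Z i j)

  infixl 7 _∙_
  _∙_ : Matrix m n → Matrix n p → Matrix m p
  (X ∙ Y) i j = sum (λ k → X i k * Y k j)

  _ᵀ : Matrix m n → Matrix n m
  (X ᵀ) i j = X j i

  ∙-congˡ : (X : Matrix m n) {Y Z : Matrix n p} → Y ≋ Z → X ∙ Y ≋ X ∙ Z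
  ∙-congˡ X Y≋Z i j = sum-cong-≋ (λ k → *-congˡ (Y≋Z k j))

  ∙-congʳ : {X Y : Matrix m n} (Z : Matrix n p) → X ≋ Y → X ∙ Z ≋ Y ∙ Z
  ∙-congʳ Z X≋Y i j = sum-cong-≋ (λ k → *-congʳ (X≋Y i k))

  ∙-assoc : (X : Matrix m n) (Y : Matrix n p) (Z : Matrix p q) → (X ∙ Y) ∙ Z ≋ X ∙ (Y ∙ Z)
  ∙-assoc X Y Z i j = begin
    sum (λ l → sum (λ k → X i k * Y k l) * Z l j)   ≈⟨ sum-cong-≋ (λ l → *-distribʳ-sum (Z l j) (λ k → X i k * Y k l)) ⟩
    sum (λ l → sum (λ k → X i k * Y k l * Z l j))   ≈⟨ ∑-comm (λ l k → X i k * Y k l * Z l j) ⟩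
    sum (λ k → sum (λ l → X i k * Y k l * Z l j))   ≈⟨ sum-cong-≋ (λ k → sum-cong-≋ (λ l → *-assoc (X i k) (Y k l) (Z l j))) ⟩
    sum (λ k → sum (λ l → X i k * (Y k l * Z l j))) ≈⟨ sum-cong-≋ (λ k → *-distribˡ-sum (X i k) (λ l → Y k l * Z l j)) ⟨
    sum (λ k → X i k * sum (λ l → Y k l * Z l j))   ∎

  ᵀ-∙ : (X : Matrix m n) (Y : Matrix n p) → (X ∙ Y) ᵀ ≋ Y ᵀ ∙ X ᵀ
  ᵀ-∙ X Y i j = sum-cong-≋ (λ k → *-comm (X j k) (Y k i))

  1M : Matrix n n
  1M zero    zero    = 1#
  1M zero    (suc _) = 0#
  1M (suc _) zero    = 0#
  1M (suc i) (suc j) = 1M i j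

  1M-diagonal : (i : Fin n) → 1M i i ≡ 1#
  1M-diagonal zero    = ≡.refl
  1M-diagonal (suc i) = 1M-diagonal i

  1M-offDiagonal : {i j : Fin n} → i ≢ j → 1M i j ≡ 0#
  1M-offDiagonal {i = zero}  {zero}  i≢j = ⊥-elim (i≢j ≡.refl)
  1M-offDiagonal {i = zero}  {suc j} i≢j = ≡.refl
  1M-offDiagonal {i = suc i} {zero}  i≢j = ≡.refl
  1M-offDiagonal {i = suc i} {suc j} i≢j = 1M-offDiagonal (λ i≡j → i≢j (≡.cong suc i≡j))

  1M-symmetric : (i j : Fin n) → 1M i j ≡ 1M j i
  1M-symmetric zero    zero    = ≡.refl
  1M-symmetric zero    (suc j) = ≡.refl
  1M-symmetric (suc i) zero    = ≡.refl
  1M-symmetric (suc i) (suc j) = 1M-symmetric i j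

  sum-1M-select : (i : Fin n) (f : Fin n → Carrier) → sum (λ k → 1M i k * f k) ≈ f i
  sum-1M-select {suc n} zero f = begin
    1# * f zero + sum (λ k → 0# * f (suc k)) ≈⟨ +-cong (*-identityˡ _) (sum-≈0 _ (λ k → zeroˡ (f (suc k)))) ⟩
    f zero + 0#                              ≈⟨ +-identityʳ _ ⟩
    f zero                                   ∎
  sum-1M-select {suc n} (suc i) f = begin
    0# * f zero + sum (λ k → 1M i k * f (suc k)) ≈⟨ +-cong (zeroˡ _) (sum-1M-select i (λ k → f (suc k))) ⟩
    0# + f (suc i)                               ≈⟨ +-identityˡ _ ⟩
    f (suc i)                                    ∎

  ∙-identityˡ : (X : Matrix m n) → 1M ∙ X ≋ X
  ∙-identityˡ X i j = sum-1M-select i (λ k → X k j)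

  record GL (n : ℕ) : Set (c ⊔ ℓ) where
    field
      mat inv  : Matrix n n
      inverseʳ : mat ∙ inv ≋ 1M
      inverseˡ : inv ∙ mat ≋ 1M

  open GL public using (mat; inv)

  GL-1 : GL n
  GL-1 = record { mat = 1M ; inv = 1M ; inverseʳ = ∙-identityˡ 1M ; inverseˡ = ∙-identityˡ 1M }

  ∙-inverse : {A B A′ B′ : Matrix n n} → A ∙ B ≋ 1M → A′ ∙ B′ ≋ 1M → (A ∙ A′) ∙ (B′ ∙ B) ≋ 1M
  ∙-inverse {A = A} {B} {A′} {B′} AB≋1 A′B′≋1 =
    ≋-trans (∙-assoc A A′ (B′ ∙ B)) (≋-trans (∙-congˡ A inner) AB≋1)
    where
    inner : A′ ∙ (B′ ∙ B) ≋ B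
    inner i j = trans (sym (∙-assoc A′ B′ B i j))
                      (trans (∙-congʳ B A′B′≋1 i j) (∙-identityˡ B i j))

  infixl 7 _GL∙_
  _GL∙_ : GL n → GL n → GL n
  g GL∙ g′ = record
    { mat      = mat g ∙ mat g′
    ; inv      = inv g′ ∙ inv g
    ; inverseʳ = ∙-inverse (GL.inverseʳ g) (GL.inverseʳ g′)
    ; inverseˡ = ∙-inverse (GL.inverseˡ g′) (GL.inverseˡ g)
    }

  GL-ᵀ : GL n → GL n
  GL-ᵀ g = record
    { mat      = mat g ᵀ
    ; inv      = inv g ᵀ
    ; inverseʳ = transposed (GL.inverseˡ g)
    ; inverseˡ = transposed (GL.inverseʳ g)
    }
    where
    transposed : {A B : Matrix n n} → B ∙ A ≋ 1M → A ᵀ ∙ B ᵀ ≋ 1M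
    transposed {A = A} {B} BA≋1 i j =
      trans (sym (ᵀ-∙ B A i j)) (trans (BA≋1 j i) (reflexive (1M-symmetric j i)))

  permutationMatrix : Permutation n n → Matrix n n
  permutationMatrix π i k = 1M (π ⟨$⟩ʳ i) k

  permutationMatrix-∙ : (π : Permutation n n) (X : Matrix n m) → permutationMatrix π ∙ X ≋ λ i → X (π ⟨$⟩ʳ i)
  permutationMatrix-∙ π X i j = sum-1M-select (π ⟨$⟩ʳ i) (λ k → X k j)

  permutationGL : Permutation n n → GL n
  permutationGL {n} π = record
    { mat      = permutationMatrix π
    ; inv      = permutationMatrix π⁻¹
    ; inverseʳ = λ i j → trans (permutationMatrix-∙ π (permutationMatrix π⁻¹) i j)
                               (reflexive (≡.cong (λ k → 1M k j) (Perm.inverseˡ π)))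
    ; inverseˡ = λ i j → trans (permutationMatrix-∙ π⁻¹ (permutationMatrix π) i j)
                               (reflexive (≡.cong (λ k → 1M k j) (Perm.inverseʳ π)))
    }
    where
    π⁻¹ : Permutation n n
    π⁻¹ = Perm.flip π

  shear : (Fin n → Carrier) → Matrix (suc n) (suc n)
  shear c zero    k       = 1M zero k
  shear c (suc j) zero    = c j
  shear c (suc j) (suc k) = 1M j k

  shear-∙-suc : (c : Fin n → Carrier) (X : Matrix (suc n) m) (j : Fin n) (t : Fin m) →
                (shear c ∙ X) (suc j) t ≈ c j * X zero t + X (suc j) t
  shear-∙-suc c X j t = +-congˡ (sum-1M-select j (λ k → X (suc k) t))

  shear-inverse : {c d : Fin n → Carrier} → (∀ j → c j + d j ≈ 0#) → shear c ∙ shear d ≋ 1M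
  shear-inverse {d = d} c+d≈0 zero t = sum-1M-select zero (λ k → shear d k t)
  shear-inverse {c = c} {d} c+d≈0 (suc j) zero = begin
    (shear c ∙ shear d) (suc j) zero ≈⟨ shear-∙-suc c (shear d) j zero ⟩
    c j * 1# + d j                   ≈⟨ +-congʳ (*-identityʳ (c j)) ⟩
    c j + d j                        ≈⟨ c+d≈0 j ⟩
    0#                               ∎
  shear-inverse {c = c} {d} c+d≈0 (suc j) (suc k) = begin
    (shear c ∙ shear d) (suc j) (suc k) ≈⟨ shear-∙-suc c (shear d) j (suc k) ⟩
    c j * 0# + 1M j k                   ≈⟨ +-congʳ (zeroʳ (c j)) ⟩
    0# + 1M j k                         ≈⟨ +-identityˡ (1M j k) ⟩
    1M j k                              ∎

  shearGL : (Fin n → Carrier) → GL (suc n)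
  shearGL c = record
    { mat      = shear c
    ; inv      = shear (λ j → - c j)
    ; inverseʳ = shear-inverse (λ j → -‿inverseʳ (c j))
    ; inverseˡ = shear-inverse (λ j → -‿inverseˡ (c j))
    }

  extend : Matrix n n → Matrix (suc n) (suc n)
  extend A zero    k       = 1M zero k
  extend A (suc j) zero    = 0#
  extend A (suc j) (suc k) = A j k

  extend-∙-suc : (A : Matrix n n) (X : Matrix (suc n) m) (j : Fin n) (t : Fin m) →
                 (extend A ∙ X) (suc j) t ≈ (A ∙ (λ k → X (suc k))) j t
  extend-∙-suc A X j t = trans (+-congʳ (zeroˡ (X zero t))) (+-identityˡ _)

  extend-inverse : {A B : Matrix n n} → A ∙ B ≋ 1M → extend A ∙ extend B ≋ 1M
  extend-inverse {B = B} AB≋1 zero t = sum-1M-select zero (λ k → extend B k t)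
  extend-inverse {A = A} {B} AB≋1 (suc j) zero =
    trans (extend-∙-suc A (extend B) j zero) (sum-≈0 (λ k → A j k * 0#) (λ k → zeroʳ (A j k)))
  extend-inverse {A = A} {B} AB≋1 (suc j) (suc k) =
    trans (extend-∙-suc A (extend B) j (suc k)) (AB≋1 j k)

  extendGL : GL n → GL (suc n)
  extendGL g = record
    { mat      = extend (mat g)
    ; inv      = extend (inv g)
    ; inverseʳ = extend-inverse (GL.inverseʳ g)
    ; inverseˡ = extend-inverse (GL.inverseˡ g)
    }

module GaussianElimination {c ℓ} (F : Field c ℓ)
                           (≈0? : ∀ x → Dec (Field._≈_ F x (Field.0# F))) where
  open Field F hiding (zero)
  open MatrixAlgebra commutativeRing
  open import Algebra.Properties.AbelianGroup +-abelianGroup using (\\-leftDividesˡ)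
  open import Relation.Binary.Reasoning.Setoid setoid

  private
    variable
      h m : ℕ

  record RowReduction (u : Matrix h m) : Set (c ⊔ ℓ) where
    field
      transform : GL h
      reduced   : Matrix h m
      factorise : u ≋ mat transform ∙ reduced
      zeroRows  : Subset h
      enough    : h ∸ m ≤ ∣ zeroRows ∣
      vanishes  : ∀ {k} → k ∈ zeroRows → ∀ t → reduced k t ≈ 0#

  reduction-noColumns : (u : Matrix h zero) → RowReduction u
  reduction-noColumns {h} u = record
    { transform = GL-1
    ; reduced   = u
    ; factorise = λ i t → sym (∙-identityˡ u i t)
    ; zeroRows  = ⊤
    ; enough    = ≤-reflexive (≡.sym (∣⊤∣≡n h))
    ; vanishes  = λ _ ()
    }

  reduction-∙ : {u : Matrix h m} {v : Matrix h m} (g : GL h) →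
                u ≋ mat g ∙ v → RowReduction v → RowReduction u
  reduction-∙ g u≋gv ρ = record
    { transform = g GL∙ transform
    ; reduced   = reduced
    ; factorise = λ i t → trans (u≋gv i t)
                    (trans (∙-congˡ (mat g) factorise i t) (sym (∙-assoc (mat g) (mat transform) reduced i t)))
    ; zeroRows  = zeroRows
    ; enough    = enough
    ; vanishes  = vanishes
    }
    where open RowReduction ρ

  reduction-permuteRows : {u : Matrix h m} (π : Permutation h h) →
                          RowReduction (λ i → u (π ⟨$⟩ʳ i)) → RowReduction u
  reduction-permuteRows {u = u} π = reduction-∙ (permutationGL (Perm.flip π)) u≋Pπu
    where
    u≋Pπu : u ≋ permutationMatrix (Perm.flip π) ∙ (λ i → u (π ⟨$⟩ʳ i))
    u≋Pπu i t = sym (trans (permutationMatrix-∙ (Perm.flip π) (λ i → u (π ⟨$⟩ʳ i)) i t)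
                           (reflexive (≡.cong (λ k → u k t) (Perm.inverseʳ π))))

  reduction-zeroColumn : {u : Matrix h (suc m)} → (∀ i → u i zero ≈ 0#) →
                         RowReduction (λ i t → u i (suc t)) → RowReduction u
  reduction-zeroColumn {h} {m} {u} column≈0 ρ = record
    { transform = transform
    ; reduced   = reduced′
    ; factorise = factorise′
    ; zeroRows  = zeroRows
    ; enough    = ≤-trans (∸-monoʳ-≤ h (n≤1+n m)) enough
    ; vanishes  = vanishes′
    }
    where
    open RowReduction ρ
    reduced′ : Matrix h (suc m)
    reduced′ k = 0# Vector.∷ reduced k
    factorise′ : u ≋ mat transform ∙ reduced′
    factorise′ i zero    = trans (column≈0 i) (sym (sum-≈0 (λ k → mat transform i k * 0#) (λ k → zeroʳ _)))
    factorise′ i (suc t) = factorise i t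
    vanishes′ : ∀ {k} → k ∈ zeroRows → ∀ t → reduced′ k t ≈ 0#
    vanishes′ k∈S zero    = refl
    vanishes′ k∈S (suc t) = vanishes k∈S t

  reduction-extend : {u : Matrix (suc h) (suc m)} → (∀ j → u (suc j) zero ≈ 0#) →
                     RowReduction (λ j t → u (suc j) (suc t)) → RowReduction u
  reduction-extend {h} {m} {u} column≈0 ρ = record
    { transform = extendGL transform
    ; reduced   = reduced′
    ; factorise = factorise′
    ; zeroRows  = false ∷ zeroRows
    ; enough    = enough
    ; vanishes  = vanishes′
    }
    where
    open RowReduction ρ
    reduced′ : Matrix (suc h) (suc m)
    reduced′ = u zero Vector.∷ λ k → 0# Vector.∷ reduced k
    factorise′ : u ≋ extend (mat transform) ∙ reduced′
    factorise′ zero    t       = sym (sum-1M-select zero (λ k → reduced′ k t))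
    factorise′ (suc j) zero    = trans (column≈0 j) (sym (trans
      (extend-∙-suc (mat transform) reduced′ j zero)
      (sum-≈0 (λ k → mat transform j k * 0#) (λ k → zeroʳ _))))
    factorise′ (suc j) (suc t) = trans (factorise j t) (sym (extend-∙-suc (mat transform) reduced′ j (suc t)))
    vanishes′ : ∀ {k} → k ∈ false ∷ zeroRows → ∀ t → reduced′ k t ≈ 0#
    vanishes′ (there k∈S) zero    = refl
    vanishes′ (there k∈S) (suc t) = vanishes k∈S t

  module ClearColumn {h m} (u : Matrix (suc h) (suc m)) (pivot≉0 : ¬ u zero zero ≈ 0#) where
    pivot pivot⁻¹ : Carrier
    pivot   = u zero zero
    pivot⁻¹ = proj₁ (inverse pivot pivot≉0)

    multiplier : Fin h → Carrier
    multiplier j = u (suc j) zero * pivot⁻¹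

    cleared : Matrix (suc h) (suc m)
    cleared zero    t = u zero t
    cleared (suc j) t = - (multiplier j * u zero t) + u (suc j) t

    multiplier-pivot : ∀ j → multiplier j * pivot ≈ u (suc j) zero
    multiplier-pivot j = begin
      u (suc j) zero * pivot⁻¹ * pivot   ≈⟨ *-assoc _ pivot⁻¹ pivot ⟩
      u (suc j) zero * (pivot⁻¹ * pivot) ≈⟨ *-congˡ (trans (*-comm pivot⁻¹ pivot) (proj₂ (inverse pivot pivot≉0))) ⟩
      u (suc j) zero * 1#                ≈⟨ *-identityʳ _ ⟩
      u (suc j) zero                     ∎

    cleared-column : ∀ j → cleared (suc j) zero ≈ 0#
    cleared-column j = trans (+-congʳ (-‿cong (multiplier-pivot j))) (-‿inverseˡ (u (suc j) zero))

    u≋shear∙cleared : u ≋ shear multiplier ∙ cleared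
    u≋shear∙cleared zero    t = sym (sum-1M-select zero (λ k → cleared k t))
    u≋shear∙cleared (suc j) t = sym (trans (shear-∙-suc multiplier cleared j t)
                                          (\\-leftDividesˡ (multiplier j * u zero t) (u (suc j) t)))

  rowReduce : ∀ m {h} (u : Matrix h m) → RowReduction u
  rowReduce zero          u = reduction-noColumns u
  rowReduce (suc m) {zero} u = reduction-zeroColumn (λ ()) (rowReduce m _)
  rowReduce (suc m) {suc h} u with all? (λ i → ≈0? (u i zero))
  ... | yes column≈0 = reduction-zeroColumn column≈0 (rowReduce m _)
  ... | no column≉0 with ¬∀⟶∃¬ (suc h) _ (λ i → ≈0? (u i zero)) column≉0
  ...   | p , up≉0 = reduction-permuteRows swap
                       (reduction-∙ {v = cleared} (shearGL multiplier) u≋shear∙cleared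
                         (reduction-extend cleared-column (rowReduce m _)))
    where
    swap : Permutation (suc h) (suc h)
    swap = Perm.transpose zero p
    open ClearColumn (λ i → u (swap ⟨$⟩ʳ i)) up≉0

module Substitution {c ℓ} (F : Field c ℓ) where
  open Field F hiding (zero)
  open Forms F
  open MatrixAlgebra commutativeRing
  open import Algebra.Properties.Semiring.Sum semiring
    using (sum-cong-≋; ∑-comm; *-distribˡ-sum; *-distribʳ-sum)
  open import Algebra.Solver.CommutativeMonoid *-commutativeMonoid using (solve; _⊕_; _⊜_)
  open import Relation.Binary.Reasoning.Setoid setoid

  private
    variable
      m n p : ℕ

  pullbackL : Matrix m n → LinearForm m → LinearForm n
  pullbackL B L c = Σ[ (λ a → L a * B a c) ]

  pullbackQ : Matrix m n → QuadForm m → QuadForm n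
  pullbackQ B N c d = pullbackL B (λ a → pullbackL B (N a) d) c

  pullbackC : Matrix m n → CubicForm m → CubicForm n
  pullbackC B T e c d = pullbackL B (λ a → pullbackQ B (T a) c d) e

  sum-exchange : (f : Fin m → Fin n → Carrier) (z : Fin n → Carrier) →
                 Σ[ (λ a → Σ[ (λ d → f a d * z d) ]) ] ≈ evalL (λ d → Σ[ (λ a → f a d) ]) z
  sum-exchange f z = begin
    Σ[ (λ a → Σ[ (λ d → f a d * z d) ]) ] ≈⟨ ∑-comm (λ a d → f a d * z d) ⟩
    Σ[ (λ d → Σ[ (λ a → f a d * z d) ]) ] ≈⟨ sum-cong-≋ (λ d → *-distribʳ-sum (z d) (λ a → f a d)) ⟨
    Σ[ (λ d → Σ[ (λ a → f a d) ] * z d) ] ∎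

  pullbackL-cong : (B : Matrix m n) {L L′ : LinearForm m} → (∀ a → L a ≈ L′ a) → ∀ c → pullbackL B L c ≈ pullbackL B L′ c
  pullbackL-cong B L≈L′ c = sum-cong-≋ (λ a → *-congʳ (L≈L′ a))

  evalL-congˡ : {L L′ : LinearForm n} → (∀ a → L a ≈ L′ a) → ∀ x → evalL L x ≈ evalL L′ x
  evalL-congˡ L≈L′ x = sum-cong-≋ (λ a → *-congʳ (L≈L′ a))

  evalQ-congˡ : {N N′ : QuadForm n} → (∀ a b → N a b ≈ N′ a b) → ∀ x → evalQ N x ≈ evalQ N′ x
  evalQ-congˡ N≈N′ x = sum-cong-≋ (λ a → sum-cong-≋ (λ b → *-congʳ (*-congʳ (N≈N′ a b))))

  evalQ-congʳ : (N : QuadForm n) {x y : Fin n → Carrier} → (∀ a → x a ≈ y a) → evalQ N x ≈ evalQ N y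
  evalQ-congʳ N x≈y = sum-cong-≋ (λ a → sum-cong-≋ (λ b → *-cong (*-congˡ (x≈y a)) (x≈y b)))

  evalC-congʳ : (T : CubicForm n) {x y : Fin n → Carrier} → (∀ a → x a ≈ y a) → evalC T x ≈ evalC T y
  evalC-congʳ T x≈y = sum-cong-≋ (λ a → sum-cong-≋ (λ b → sum-cong-≋ (λ d →
    *-cong (*-cong (*-congˡ (x≈y a)) (x≈y b)) (x≈y d))))

  evalQ-nested : (N : QuadForm n) (x : Fin n → Carrier) → evalQ N x ≈ evalL (λ a → evalL (N a) x) x
  evalQ-nested N x = sum-cong-≋ λ a → begin
    Σ[ (λ b → N a b * x a * x b) ] ≈⟨ sum-cong-≋ (λ b → solve 3 (λ ν ξ η → (ν ⊕ ξ) ⊕ η ⊜ (ν ⊕ η) ⊕ ξ) refl (N a b) (x a) (x b)) ⟩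
    Σ[ (λ b → N a b * x b * x a) ] ≈⟨ *-distribʳ-sum (x a) (λ b → N a b * x b) ⟨
    evalL (N a) x * x a            ∎

  evalC-nested : (T : CubicForm n) (x : Fin n → Carrier) → evalC T x ≈ evalL (λ a → evalQ (T a) x) x
  evalC-nested T x = sum-cong-≋ λ a → begin
    Σ[ (λ b → Σ[ (λ d → T a b d * x a * x b * x d) ]) ]
      ≈⟨ sum-cong-≋ (λ b → sum-cong-≋ (λ d →
           solve 4 (λ τ ξ η ζ → ((τ ⊕ ξ) ⊕ η) ⊕ ζ ⊜ ((τ ⊕ η) ⊕ ζ) ⊕ ξ) refl (T a b d) (x a) (x b) (x d))) ⟩
    Σ[ (λ b → Σ[ (λ d → T a b d * x b * x d * x a) ]) ]
      ≈⟨ sum-cong-≋ (λ b → *-distribʳ-sum (x a) (λ d → T a b d * x b * x d)) ⟨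
    Σ[ (λ b → Σ[ (λ d → T a b d * x b * x d) ] * x a) ]
      ≈⟨ *-distribʳ-sum (x a) (λ b → Σ[ (λ d → T a b d * x b * x d) ]) ⟨
    evalQ (T a) x * x a ∎

  evalL-pullback : (B : Matrix m n) (L : LinearForm m) (z : Fin n → Carrier) →
                   evalL L (B · z) ≈ evalL (pullbackL B L) z
  evalL-pullback B L z = begin
    Σ[ (λ a → L a * Σ[ (λ d → B a d * z d) ]) ]
      ≈⟨ sum-cong-≋ (λ a → trans (*-distribˡ-sum (L a) (λ d → B a d * z d))
                                 (sum-cong-≋ (λ d → sym (*-assoc (L a) (B a d) (z d))))) ⟩
    Σ[ (λ a → Σ[ (λ d → L a * B a d * z d) ]) ]
      ≈⟨ sum-exchange (λ a d → L a * B a d) z ⟩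
    evalL (pullbackL B L) z ∎

  pullbackL-evalL : (B : Matrix m n) (L : Fin m → LinearForm p) (z : Fin p → Carrier) (c : Fin n) →
                    pullbackL B (λ a → evalL (L a) z) c ≈ evalL (λ d → pullbackL B (λ a → L a d) c) z
  pullbackL-evalL B L z c = begin
    Σ[ (λ a → Σ[ (λ d → L a d * z d) ] * B a c) ]
      ≈⟨ sum-cong-≋ (λ a → trans (*-distribʳ-sum (B a c) (λ d → L a d * z d))
           (sum-cong-≋ (λ d → solve 3 (λ l ζ β → (l ⊕ ζ) ⊕ β ⊜ (l ⊕ β) ⊕ ζ) refl (L a d) (z d) (B a c)))) ⟩
    Σ[ (λ a → Σ[ (λ d → L a d * B a c * z d) ]) ]
      ≈⟨ sum-exchange (λ a d → L a d * B a c) z ⟩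
    evalL (λ d → pullbackL B (λ a → L a d) c) z ∎

  pullbackL-evalQ : (B : Matrix m n) (N : Fin m → QuadForm p) (z : Fin p → Carrier) (e : Fin n) →
                    pullbackL B (λ a → evalQ (N a) z) e ≈ evalQ (λ c d → pullbackL B (λ a → N a c d) e) z
  pullbackL-evalQ B N z e = begin
    pullbackL B (λ a → evalQ (N a) z) e
      ≈⟨ pullbackL-cong B (λ a → evalQ-nested (N a) z) e ⟩
    pullbackL B (λ a → evalL (λ c → evalL (N a c) z) z) e
      ≈⟨ pullbackL-evalL B (λ a c → evalL (N a c) z) z e ⟩
    evalL (λ c → pullbackL B (λ a → evalL (N a c) z) e) z
      ≈⟨ evalL-congˡ (λ c → pullbackL-evalL B (λ a → N a c) z e) z ⟩
    evalL (λ c → evalL (λ d → pullbackL B (λ a → N a c d) e) z) z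
      ≈⟨ evalQ-nested (λ c d → pullbackL B (λ a → N a c d) e) z ⟨
    evalQ (λ c d → pullbackL B (λ a → N a c d) e) z ∎

  evalQ-pullback : (B : Matrix m n) (N : QuadForm m) (z : Fin n → Carrier) →
                   evalQ N (B · z) ≈ evalQ (pullbackQ B N) z
  evalQ-pullback B N z = begin
    evalQ N (B · z)                                                ≈⟨ evalQ-nested N (B · z) ⟩
    evalL (λ a → evalL (N a) (B · z)) (B · z)                      ≈⟨ evalL-congˡ (λ a → evalL-pullback B (N a) z) (B · z) ⟩
    evalL (λ a → evalL (pullbackL B (N a)) z) (B · z)              ≈⟨ evalL-pullback B _ z ⟩
    evalL (pullbackL B (λ a → evalL (pullbackL B (N a)) z)) z      ≈⟨ evalL-congˡ (pullbackL-evalL B (λ a → pullbackL B (N a)) z) z ⟩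
    evalL (λ c → evalL (pullbackQ B N c) z) z                      ≈⟨ evalQ-nested (pullbackQ B N) z ⟨
    evalQ (pullbackQ B N) z                                        ∎

  evalC-pullback : (B : Matrix m n) (T : CubicForm m) (z : Fin n → Carrier) →
                   evalC T (B · z) ≈ evalC (pullbackC B T) z
  evalC-pullback B T z = begin
    evalC T (B · z)                                                ≈⟨ evalC-nested T (B · z) ⟩
    evalL (λ a → evalQ (T a) (B · z)) (B · z)                      ≈⟨ evalL-congˡ (λ a → evalQ-pullback B (T a) z) (B · z) ⟩
    evalL (λ a → evalQ (pullbackQ B (T a)) z) (B · z)              ≈⟨ evalL-pullback B _ z ⟩
    evalL (pullbackL B (λ a → evalQ (pullbackQ B (T a)) z)) z      ≈⟨ evalL-congˡ (pullbackL-evalQ B (λ a → pullbackQ B (T a)) z) z ⟩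
    evalL (λ e → evalQ (pullbackC B T e) z) z                      ≈⟨ evalC-nested (pullbackC B T) z ⟨
    evalC (pullbackC B T) z                                        ∎

module NumberField {c ℓ} (F : Field c ℓ) (NF : IsNumberField F) where
  open Field F
  open IsNumberField NF
  open MatrixAlgebra commutativeRing using (sum-≈0)
  open import Algebra.Properties.Group +-group using (∙-cancelˡ)
  open import Relation.Binary.Reasoning.Setoid setoid

  ι-0 : ι ℚ.0ℚ ≈ 0#
  ι-0 = ∙-cancelˡ (ι ℚ.0ℚ) (ι ℚ.0ℚ) 0# (begin
    ι ℚ.0ℚ + ι ℚ.0ℚ      ≈⟨ ι-+ ℚ.0ℚ ℚ.0ℚ ⟨
    ι (ℚ.0ℚ ℚ.+ ℚ.0ℚ)    ≡⟨ ≡.cong ι (ℚ.+-identityˡ ℚ.0ℚ) ⟩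
    ι ℚ.0ℚ               ≈⟨ +-identityʳ (ι ℚ.0ℚ) ⟨
    ι ℚ.0ℚ + 0#          ∎)

  ≈0? : ∀ x → Dec (x ≈ 0#)
  ≈0? x with spans x
  ... | a , x≈∑aιb with all? (λ i → a i ℚ.≟ ℚ.0ℚ)
  ...   | yes a≡0 = yes (trans x≈∑aιb (sum-≈0 _ λ i →
                      trans (*-congʳ (trans (reflexive (≡.cong ι (a≡0 i))) ι-0)) (zeroˡ (basis i))))
  ...   | no a≢0  = no λ x≈0 → a≢0 (indep a (trans (sym x≈∑aιb) x≈0))

module StrongEquivalence {c ℓ} (F : Field c ℓ) where
  open Field F hiding (zero)
  open Forms F
  open MatrixAlgebra commutativeRing
  open Substitution F
  open import Algebra.Properties.Semiring.Sum semiring using (sum-cong-≋)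
  open import Relation.Binary.Reasoning.Setoid setoid

  -- Invertible compares with a Kronecker delta that is local to its where clause
  -- and computes by matching on i ≟ j; the copattern clauses below match on
  -- i ≟ j too, which makes that delta reduce.
  toInvertible : ∀ {n} (g : GL n) → Invertible (mat g)
  proj₁ (toInvertible g) = inv g
  proj₁ (proj₂ (toInvertible g)) i j with i ≟ j
  ... | yes ≡.refl = trans (GL.inverseʳ g i i) (reflexive (1M-diagonal i))
  ... | no i≢j     = trans (GL.inverseʳ g i j) (reflexive (1M-offDiagonal i≢j))
  proj₂ (proj₂ (toInvertible g)) i j with i ≟ j
  ... | yes ≡.refl = trans (GL.inverseˡ g i i) (reflexive (1M-diagonal i))
  ... | no i≢j     = trans (GL.inverseˡ g i j) (reflexive (1M-offDiagonal i≢j))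

  ·-leftInverse : ∀ {n} {A B : Matrix n n} → B ∙ A ≋ 1M → ∀ y c → y c ≈ (B · (A · y)) c
  ·-leftInverse {n} {A} {B} BA≋1 y c = begin
    y c                       ≈⟨ ∙-identityˡ column c 0F ⟨
    (1M ∙ column) c 0F        ≈⟨ ∙-congʳ column BA≋1 c 0F ⟨
    ((B ∙ A) ∙ column) c 0F   ≈⟨ ∙-assoc B A column c 0F ⟩
    (B · (A · y)) c           ∎
    where
    column : Matrix n 1
    column j _ = y j

  shape-substitution : ∀ {h} (A B : Matrix h h) → B ∙ A ≋ 1M →
    (M M′ : Fin h → QuadForm 4) → (∀ i a b → M i a b ≈ pullbackL A (λ k → M′ k a b) i) →
    ∀ q cc x y → shape M q cc x y ≈ shape M′ (λ j → pullbackQ B (q j)) (pullbackC B cc) x (A · y)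
  shape-substitution {h} A B BA≋1 M M′ M≈AM′ q cc x y =
    +-cong (+-cong linearInY (*-congˡ quadraticInY)) cubicInY
    where
    E : Fin h → Carrier
    E k = evalQ (M′ k) x
    linearInY : Σ[ (λ i → y i * evalQ (M i) x) ] ≈ Σ[ (λ k → (A · y) k * E k) ]
    linearInY = begin
      Σ[ (λ i → y i * evalQ (M i) x) ]  ≈⟨ sum-cong-≋ (λ i → *-comm (y i) _) ⟩
      evalL (λ i → evalQ (M i) x) y     ≈⟨ evalL-congˡ (λ i → evalQ-congˡ (M≈AM′ i) x) y ⟩
      evalL (λ i → evalQ (λ a b → pullbackL A (λ k → M′ k a b) i) x) y
                                        ≈⟨ evalL-congˡ (pullbackL-evalQ A M′ x) y ⟨
      evalL (pullbackL A E) y           ≈⟨ evalL-pullback A E y ⟨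
      evalL E (A · y)                   ≈⟨ sum-cong-≋ (λ k → *-comm (E k) _) ⟩
      Σ[ (λ k → (A · y) k * E k) ]      ∎
    quadraticInY : Σ[ (λ j → x j * evalQ (q j) y) ] ≈ Σ[ (λ j → x j * evalQ (pullbackQ B (q j)) (A · y)) ]
    quadraticInY = sum-cong-≋ λ j →
      *-congˡ {x j} (trans (evalQ-congʳ (q j) (·-leftInverse BA≋1 y)) (evalQ-pullback B (q j) (A · y)))
    cubicInY : evalC cc y ≈ evalC (pullbackC B cc) (A · y)
    cubicInY = trans (evalC-congʳ cc (·-leftInverse BA≋1 y)) (evalC-pullback B cc (A · y))

-- The 10 entries on and above the diagonal determine a symmetric 4 × 4 matrix;
-- upperIndex a b numbers the entry at positions (a, b) and (b, a).
upperIndex : Fin 4 → Fin 4 → Fin 10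
upperIndex 0F 0F = 0F
upperIndex 0F 1F = 1F
upperIndex 0F 2F = 2F
upperIndex 0F 3F = 3F
upperIndex 1F 0F = 1F
upperIndex 1F 1F = 4F
upperIndex 1F 2F = 5F
upperIndex 1F 3F = 6F
upperIndex 2F 0F = 2F
upperIndex 2F 1F = 5F
upperIndex 2F 2F = 7F
upperIndex 2F 3F = 8F
upperIndex 3F 0F = 3F
upperIndex 3F 1F = 6F
upperIndex 3F 2F = 8F
upperIndex 3F 3F = 9F

upperRow upperColumn : Fin 10 → Fin 4
upperRow 0F = 0F
upperRow 1F = 0F
upperRow 2F = 0F
upperRow 3F = 0F
upperRow 4F = 1F
upperRow 5F = 1F
upperRow 6F = 1F
upperRow 7F = 2F
upperRow 8F = 2F
upperRow 9F = 3F
upperColumn 0F = 0F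
upperColumn 1F = 1F
upperColumn 2F = 2F
upperColumn 3F = 3F
upperColumn 4F = 1F
upperColumn 5F = 2F
upperColumn 6F = 3F
upperColumn 7F = 2F
upperColumn 8F = 3F
upperColumn 9F = 3F

upperIndex-comm : ∀ a b → upperIndex a b ≡ upperIndex b a
upperIndex-comm 0F 0F = ≡.refl
upperIndex-comm 0F 1F = ≡.refl
upperIndex-comm 0F 2F = ≡.refl
upperIndex-comm 0F 3F = ≡.refl
upperIndex-comm 1F 0F = ≡.refl
upperIndex-comm 1F 1F = ≡.refl
upperIndex-comm 1F 2F = ≡.refl
upperIndex-comm 1F 3F = ≡.refl
upperIndex-comm 2F 0F = ≡.refl
upperIndex-comm 2F 1F = ≡.refl
upperIndex-comm 2F 2F = ≡.refl
upperIndex-comm 2F 3F = ≡.refl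
upperIndex-comm 3F 0F = ≡.refl
upperIndex-comm 3F 1F = ≡.refl
upperIndex-comm 3F 2F = ≡.refl
upperIndex-comm 3F 3F = ≡.refl

module SymmetricMatrices {c ℓ} (F : Field c ℓ) where
  open Field F
  open Forms F
  open MatrixAlgebra commutativeRing using (Matrix)

  upperEntries : ∀ {h} → (Fin h → QuadForm 4) → Matrix h 10
  upperEntries M i t = M i (upperRow t) (upperColumn t)

  symmetric-upperEntry : {N : QuadForm 4} → Symmetric N →
                         ∀ a b → N a b ≈ N (upperRow (upperIndex a b)) (upperColumn (upperIndex a b))
  symmetric-upperEntry N-sym 0F 0F = refl
  symmetric-upperEntry N-sym 0F 1F = refl
  symmetric-upperEntry N-sym 0F 2F = refl
  symmetric-upperEntry N-sym 0F 3F = refl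
  symmetric-upperEntry N-sym 1F 0F = N-sym 1F 0F
  symmetric-upperEntry N-sym 1F 1F = refl
  symmetric-upperEntry N-sym 1F 2F = refl
  symmetric-upperEntry N-sym 1F 3F = refl
  symmetric-upperEntry N-sym 2F 0F = N-sym 2F 0F
  symmetric-upperEntry N-sym 2F 1F = N-sym 2F 1F
  symmetric-upperEntry N-sym 2F 2F = refl
  symmetric-upperEntry N-sym 2F 3F = refl
  symmetric-upperEntry N-sym 3F 0F = N-sym 3F 0F
  symmetric-upperEntry N-sym 3F 1F = N-sym 3F 1F
  symmetric-upperEntry N-sym 3F 2F = N-sym 3F 2F
  symmetric-upperEntry N-sym 3F 3F = refl

lemma9 : ∀ {c ℓ} (F : Field c ℓ) → IsNumberField F →
    let open Field F
        open Forms F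
    in
    ∀ (h : ℕ) (C : CubicForm (4 Data.Nat.+ h)) → HInvariant C h → 11 ≤ h →
    ∀ (M : Fin h → QuadForm 4) → (∀ i → Symmetric (M i)) →
    ∀ (q : Fin 4 → QuadForm h) (cc : CubicForm h) →
    (∀ x y → evalC C (x ++ y) ≈ shape M q cc x y) →
    Σ (Fin h → Fin h → Carrier) λ A → Invertible A ×
    Σ (Fin h → QuadForm 4) λ M′ → (∀ i → Symmetric (M′ i)) ×
    Σ (Fin 4 → QuadForm h) λ q′ → Σ (CubicForm h) λ cc′ →
    (∀ x y → evalC C (x ++ y) ≈ shape M′ q′ cc′ x (A · y)) ×
    Σ (Subset h) λ S → (h ∸ 10 ≤ ∣ S ∣) ×
      (∀ i → i ∈ S → ∀ a b → M′ i a b ≈ 0#)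
lemma9 F NF h C _ _ M M-sym q cc C≈shape =
    mat g , toInvertible g , M′ , M′-symmetric , (λ j → pullbackQ (inv g) (q j)) , pullbackC (inv g) cc
  , (λ x y → trans (C≈shape x y) (shape-substitution (mat g) (inv g) (GL.inverseˡ g) M M′ M≈gM′ q cc x y))
  , zeroRows , enough , λ k k∈S a b → vanishes k∈S (upperIndex a b)
  where
  open Field F hiding (zero)
  open Forms F
  open MatrixAlgebra commutativeRing
  open GaussianElimination F (NumberField.≈0? F NF)
  open Substitution F
  open StrongEquivalence F
  open SymmetricMatrices F
  open import Algebra.Properties.Semiring.Sum semiring using (sum-cong-≋)
  open RowReduction (rowReduce 10 (upperEntries M))
  g : GL h
  g = GL-ᵀ transform
  M′ : Fin h → QuadForm 4
  M′ k a b = reduced k (upperIndex a b)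
  M′-symmetric : ∀ k → Symmetric (M′ k)
  M′-symmetric k a b = reflexive (≡.cong (reduced k) (upperIndex-comm a b))
  M≈gM′ : ∀ i a b → M i a b ≈ pullbackL (mat g) (λ k → M′ k a b) i
  M≈gM′ i a b = trans (symmetric-upperEntry (M-sym i) a b)
    (trans (factorise i (upperIndex a b)) (sum-cong-≋ λ k → *-comm (mat transform i k) (M′ k a b)))
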